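{- Let $q$ be a prime power, let $n\ge2$ be an integer, let $a\in\mathbb{F}_q^*$ and let $f:\mathbb{F}_q\to\mathbb{F}_q$ be $f(x)=ax^n$. Let $q^*(n)$ be the largest divisor of $q-1$ that is relatively prime to $n$. Then $f$ has exactly $q^*(n)+1$ periodic points in $\mathbb{F}_q$.
   Context: A point $x_0\in\mathbb{F}_q$ is a periodic point of $f$ if $f^{\circ r}(x_0)=x_0$ for some positive integer $r$, where $f^{\circ r}$ is the $r$-th iterate of $f$. -}

module Defs where

open import Level using (Level; _⊔_)
open import Algebra.Bundles using (CommutativeRing)
open import Data.Nat using (ℕ; zero; suc; _≤_)
open import Data.Nat.Divisibility using (_∣_)
open import Data.Nat.Coprimality using (Coprime)
open import Data.Fin using (Fin)
open import Data.Product using (Σ; ∃; _×_)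
open import Relation.Nullary using (¬_)
open import Relation.Binary.PropositionalEquality using (_≡_)

IsLargestCoprimeDivisor : ℕ → ℕ → ℕ → Set
IsLargestCoprimeDivisor d m n =
  d ∣ m × Coprime d n × (∀ e → e ∣ m → Coprime e n → e ≤ d)

module _ {c ℓ} (R : CommutativeRing c ℓ) where
  open CommutativeRing R
  open import Algebra.Properties.Semiring.Exp semiring using () renaming (_^_ to _^ᴿ_)

  IsField : Set (c ⊔ ℓ)
  IsField = (¬ (1# ≈ 0#)) × (∀ x → ¬ (x ≈ 0#) → ∃ λ y → x * y ≈ 1#)

  HasCardinality : ℕ → Set (c ⊔ ℓ)
  HasCardinality k = Σ (Fin k → Carrier) λ g →
    (∀ i j → g i ≈ g j → i ≡ j) × (∀ x → ∃ λ i → g i ≈ x)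

  CountIs : ∀ {p} → (Carrier → Set p) → ℕ → Set (c ⊔ ℓ ⊔ p)
  CountIs P k = Σ (Fin k → Carrier) λ g →
    (∀ i j → g i ≈ g j → i ≡ j) × (∀ x → (P x → ∃ λ i → g i ≈ x) × ((∃ λ i → g i ≈ x) → P x))

  iterate : (Carrier → Carrier) → ℕ → Carrier → Carrier
  iterate f zero x = x
  iterate f (suc r) x = f (iterate f r x)

  IsPeriodicPoint : (Carrier → Carrier) → Carrier → Set ℓ
  IsPeriodicPoint f x = ∃ λ r → 1 ≤ r × iterate f r x ≈ x

  powerMap : Carrier → ℕ → Carrier → Carrier
  powerMap a n x = a * (x ^ᴿ n)

module Submission where

-- Write m = e·d; maximality of d forces gcd(d, e) = 1 and e ∣ n^K for some K
-- (Arithmetic).  Iterating gives f^k(y) = f^k(1)·y^(n^k), so by Lagrange's theorem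
-- (x^m = 1 for x ≠ 0) f^K sends every nonzero y into T = {x | x^d = b} with
-- b = (f^K 1)^d.  T is f-invariant, and f is injective on T because xⁿ = yⁿ and
-- x^d = y^d force x = y (Bézout, gcd(d, n) = 1).  Hence the periodic points are
-- exactly 0 and the points of T: a nonzero periodic point is an f^K-image, and an
-- injective self-map of a finite set is a permutation.  Finally T has exactly d
-- elements: at most d as the roots of x^d - b (root bound for polynomials), and at
-- least d because x ↦ (f^K(1)·x^e, x^d) embeds the m units into T × {x | x^e = 1}.

open import Defs
open import Algebra.Bundles using (CommutativeRing)
open import Data.Nat using (ℕ; suc; _≤_; _∸_)
open import Relation.Nullary using (¬_)

open import Data.Nat as Nat using (zero; z≤n; s≤s)
import Data.Nat.Properties as ℕP
open import Data.Nat.Divisibility using (_∣_; divides; ∣-refl; ∣-trans; *-pres-∣; *-monoˡ-∣; 0∣⇒≡0)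
open import Data.Nat.Coprimality as Coprimality using (Coprime; coprime?; coprime-divisor)
open import Data.Nat.GCD using (module Bézout)
open import Data.Fin as Fin using (Fin; zero; suc)
import Data.Fin.Properties as FinP
open import Data.Fin.Permutation using (permutation)
open import Data.Vec using (Vec; []; _∷_; replicate)
open import Data.Product using (∃; _×_; _,_; proj₁; proj₂)
open import Data.Sum using (_⊎_; inj₁; inj₂; [_,_])
open import Data.Empty using (⊥-elim)
open import Function using (_∘_)
open import Relation.Nullary using (Dec; yes; no)
open import Relation.Unary using (Decidable)
open import Relation.Binary.PropositionalEquality as ≡ using (_≡_; _≢_)

module Arithmetic where
  open Nat using (_*_; _^_; _<_; ≢-nonZero)
  open import Data.Nat.Induction using (<-rec)
  open import Data.Nat.GCD using (gcd; gcd[m,n]∣m; gcd[m,n]∣n; gcd[m,n]≢0)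

  factors-nonzero : ∀ {m} e d → m ≢ 0 → m ≡ e * d → e ≢ 0 × d ≢ 0
  factors-nonzero e d m≢0 m≡ed =
    (λ e≡0 → m≢0 (≡.trans m≡ed (≡.cong (_* d) e≡0))) ,
    (λ d≡0 → m≢0 (≡.trans m≡ed (≡.trans (≡.cong (e *_) d≡0) (ℕP.*-zeroʳ e))))

  coprime-∣ : ∀ {i d n} → i ∣ d → Coprime d n → Coprime i n
  coprime-∣ i∣d d⊥n (j∣i , j∣n) = d⊥n (∣-trans j∣i i∣d , j∣n)

  coprime-* : ∀ {a b n} → Coprime a n → Coprime b n → Coprime (a * b) n
  coprime-* {a} a⊥n b⊥n {j} (j∣ab , j∣n) = b⊥n (coprime-divisor j⊥a j∣ab , j∣n)
    where
    j⊥a : Coprime j a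
    j⊥a (t∣j , t∣a) = a⊥n (t∣a , ∣-trans t∣j j∣n)

  -- A positive e whose only divisor coprime to n is 1 divides a power of n:
  -- split off g = gcd(e, n) > 1 and recurse on the smaller cofactor e / g.
  divides-power : ∀ n e → e ≢ 0 → (∀ c → c ∣ e → Coprime c n → c ≡ 1) → ∃ λ K → e ∣ n ^ K
  divides-power n = <-rec Goal step
    where
    Goal : ℕ → Set
    Goal e = e ≢ 0 → (∀ c → c ∣ e → Coprime c n → c ≡ 1) → ∃ λ K → e ∣ n ^ K

    step : ∀ e → (∀ {e'} → e' < e → Goal e') → Goal e
    step e rec e≢0 only-1 with coprime? e n
    ... | yes e⊥n = 0 , ≡.subst (_∣ 1) (≡.sym (only-1 e ∣-refl e⊥n)) ∣-refl
    ... | no ¬e⊥n with gcd[m,n]∣m e n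
    ...   | divides e' e≡e'*g = suc K , ≡.subst (_∣ n ^ suc K) (≡.sym e≡e'*g) e'g∣nᴷ⁺¹
      where
      g = gcd e n
      1<g : 1 < g
      1<g = ℕP.≤∧≢⇒< (ℕP.n≢0⇒n>0 (gcd[m,n]≢0 e n (inj₁ e≢0)))
                      (λ 1≡g → ¬e⊥n (Coprimality.gcd≡1⇒coprime (≡.sym 1≡g)))
      e'≢0 : e' ≢ 0
      e'≢0 e'≡0 = e≢0 (≡.trans e≡e'*g (≡.cong (_* g) e'≡0))
      e'<e : e' < e
      e'<e = ≡.subst (e' <_) (≡.sym e≡e'*g) (ℕP.m<m*n e' g {{≢-nonZero e'≢0}} 1<g)
      e'-only-1 : ∀ c → c ∣ e' → Coprime c n → c ≡ 1
      e'-only-1 c c∣e' = only-1 c (∣-trans c∣e' (≡.subst (e' ∣_) (≡.sym e≡e'*g) (divides g (ℕP.*-comm e' g))))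
      IH : ∃ λ K → e' ∣ n ^ K
      IH = rec e'<e e'≢0 e'-only-1
      K = proj₁ IH
      e'g∣nᴷ⁺¹ : e' * g ∣ n ^ suc K
      e'g∣nᴷ⁺¹ = ≡.subst (e' * g ∣_) (ℕP.*-comm (n ^ K) n) (*-pres-∣ (proj₂ IH) (gcd[m,n]∣n e n))

  record CoprimeCofactor (m n d : ℕ) : Set where
    field
      e K    : ℕ
      m≡e*d  : m ≡ e * d
      d⊥e    : Coprime d e
      e∣nᴷ   : e ∣ n ^ K

  largest-coprime-cofactor : ∀ {m n d} → m ≢ 0 → IsLargestCoprimeDivisor d m n → CoprimeCofactor m n d
  largest-coprime-cofactor {m} {n} {d} m≢0 (divides e m≡e*d , d⊥n , largest) = record
    { e = e ; K = proj₁ power ; m≡e*d = m≡e*d ; d⊥e = d⊥e ; e∣nᴷ = proj₂ power }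
    where
    e≢0 = proj₁ (factors-nonzero e d m≢0 m≡e*d)
    d≢0 = proj₂ (factors-nonzero e d m≢0 m≡e*d)
    -- a divisor c of e coprime to n would make c * d a larger coprime divisor of m
    only-1 : ∀ c → c ∣ e → Coprime c n → c ≡ 1
    only-1 c c∣e c⊥n = ℕP.≤-antisym c≤1 (ℕP.n≢0⇒n>0 c≢0)
      where
      c≢0 : c ≢ 0
      c≢0 c≡0 = e≢0 (0∣⇒≡0 (≡.subst (_∣ e) c≡0 c∣e))
      cd≤d : c * d ≤ d
      cd≤d = largest (c * d) (≡.subst (c * d ∣_) (≡.sym m≡e*d) (*-monoˡ-∣ d c∣e)) (coprime-* c⊥n d⊥n)
      c≤1 : c ≤ 1
      c≤1 = ℕP.*-cancelʳ-≤ c 1 d {{≢-nonZero d≢0}} (≡.subst (c * d ≤_) (≡.sym (ℕP.*-identityˡ d)) cd≤d)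
    power : ∃ λ K → e ∣ n ^ K
    power = divides-power n e e≢0 only-1
    d⊥e : Coprime d e
    d⊥e (j∣d , j∣e) = only-1 _ j∣e (coprime-∣ j∣d d⊥n)

open Arithmetic using (factors-nonzero; CoprimeCofactor; largest-coprime-cofactor)

record Selection {p} (k : ℕ) (Q : Fin k → Set p) : Set p where
  field
    size     : ℕ
    pick     : Fin size → Fin k
    pick-injective : ∀ i j → pick i ≡ pick j → i ≡ j
    pick-sound     : ∀ i → Q (pick i)
    pick-complete  : ∀ i → Q i → ∃ λ j → pick j ≡ i

select : ∀ {p} k (Q : Fin k → Set p) → Decidable Q → Selection k Q
select zero    Q Q? = record
  { size = 0 ; pick = λ () ; pick-injective = λ () ; pick-sound = λ () ; pick-complete = λ () }
select (suc k) Q Q? with Q? zero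
... | yes Q0 = record
  { size = suc S.size ; pick = pick ; pick-injective = pick-injective
  ; pick-sound = pick-sound ; pick-complete = pick-complete }
  where
  module S = Selection (select k (Q ∘ suc) (Q? ∘ suc))
  pick : Fin (suc S.size) → Fin (suc k)
  pick zero    = zero
  pick (suc j) = suc (S.pick j)
  pick-injective : ∀ i j → pick i ≡ pick j → i ≡ j
  pick-injective zero    zero    _  = ≡.refl
  pick-injective (suc i) (suc j) eq = ≡.cong suc (S.pick-injective i j (FinP.suc-injective eq))
  pick-sound : ∀ i → Q (pick i)
  pick-sound zero    = Q0
  pick-sound (suc j) = S.pick-sound j
  pick-complete : ∀ i → Q i → ∃ λ j → pick j ≡ i
  pick-complete zero    _  = zero , ≡.refl
  pick-complete (suc i) Qi = suc (proj₁ (S.pick-complete i Qi)) , ≡.cong suc (proj₂ (S.pick-complete i Qi))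
... | no ¬Q0 = record
  { size = S.size ; pick = suc ∘ S.pick
  ; pick-injective = λ i j eq → S.pick-injective i j (FinP.suc-injective eq)
  ; pick-sound = S.pick-sound ; pick-complete = pick-complete }
  where
  module S = Selection (select k (Q ∘ suc) (Q? ∘ suc))
  pick-complete : ∀ i → Q i → ∃ λ j → suc (S.pick j) ≡ i
  pick-complete zero    Q0 = ⊥-elim (¬Q0 Q0)
  pick-complete (suc i) Qi = proj₁ (S.pick-complete i Qi) , ≡.cong suc (proj₂ (S.pick-complete i Qi))

module Enumeration {c ℓ} (F : CommutativeRing c ℓ) where
  open CommutativeRing F hiding (zero)

  module _ {p} {P : Carrier → Set p} {k : ℕ} (A : CountIs F P k) where
    element : Fin k → Carrier
    element = proj₁ A

    element-injective : ∀ i j → element i ≈ element j → i ≡ j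
    element-injective = proj₁ (proj₂ A)

    element-sound : ∀ i → P (element i)
    element-sound i = proj₂ (proj₂ (proj₂ A) (element i)) (i , refl)

    index : ∀ x → P x → Fin k
    index x Px = proj₁ (proj₁ (proj₂ (proj₂ A) x) Px)

    element-index : ∀ x (Px : P x) → element (index x Px) ≈ x
    element-index x Px = proj₂ (proj₁ (proj₂ (proj₂ A) x) Px)

    index-injective : ∀ {x y} (Px : P x) (Py : P y) → index x Px ≡ index y Py → x ≈ y
    index-injective {x} {y} Px Py eq =
      trans (sym (element-index x Px)) (trans (reflexive (≡.cong element eq)) (element-index y Py))

  count-insert : ∀ {p q} {P : Carrier → Set p} {Q : Carrier → Set q} {l} z →
    ¬ Q z → (∀ {x y} → x ≈ y → Q x → Q y) →
    (∀ x → P x → x ≈ z ⊎ Q x) → (∀ x → x ≈ z ⊎ Q x → P x) →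
    CountIs F Q l → CountIs F P (suc l)
  count-insert {P = P} {Q} {l} z ¬Qz Q-resp to from B = g , g-injective , λ x → complete x , sound x
    where
    g : Fin (suc l) → Carrier
    g zero    = z
    g (suc i) = element B i
    g-injective : ∀ i j → g i ≈ g j → i ≡ j
    g-injective zero    zero    _  = ≡.refl
    g-injective zero    (suc j) eq = ⊥-elim (¬Qz (Q-resp (sym eq) (element-sound B j)))
    g-injective (suc i) zero    eq = ⊥-elim (¬Qz (Q-resp eq (element-sound B i)))
    g-injective (suc i) (suc j) eq = ≡.cong suc (element-injective B i j eq)
    complete : ∀ x → P x → ∃ λ i → g i ≈ x
    complete x Px with to x Px
    ... | inj₁ x≈z = zero , sym x≈z
    ... | inj₂ Qx  = suc (index B x Qx) , element-index B x Qx
    sound : ∀ x → (∃ λ i → g i ≈ x) → P x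
    sound x (zero  , z≈x)  = from x (inj₁ (sym z≈x))
    sound x (suc i , gi≈x) = from x (inj₂ (Q-resp gi≈x (element-sound B i)))

  count-≤-× : ∀ {p q r} {P : Carrier → Set p} {Q : Carrier → Set q} {R : Carrier → Set r} {k l l'} →
    CountIs F P k → CountIs F Q l → CountIs F R l' → (f g : Carrier → Carrier) →
    (∀ x → P x → Q (f x)) → (∀ x → P x → R (g x)) →
    (∀ x y → P x → P y → f x ≈ f y → g x ≈ g y → x ≈ y) → k ≤ l Nat.* l'
  count-≤-× {k = k} {l = l} {l' = l'} A B C f g f-maps g-maps fg-inj = FinP.injective⇒≤ {f = idx} idx-injective
    where
    idx : Fin k → Fin (l Nat.* l')
    idx i = Fin.combine (index B (f (element A i)) (f-maps _ (element-sound A i)))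
                        (index C (g (element A i)) (g-maps _ (element-sound A i)))
    idx-injective : ∀ {i j} → idx i ≡ idx j → i ≡ j
    idx-injective {i} {j} eq with FinP.combine-injective _ _ _ _ eq
    ... | eqB , eqC = element-injective A i j (fg-inj _ _ (element-sound A i) (element-sound A j)
                        (index-injective B _ _ eqB) (index-injective C _ _ eqC))

module Iteration {c ℓ} (F : CommutativeRing c ℓ) (f : CommutativeRing.Carrier F → CommutativeRing.Carrier F) where
  open CommutativeRing F hiding (zero)

  iterate-+ : ∀ r u x → iterate F f (r Nat.+ u) x ≡ iterate F f r (iterate F f u x)
  iterate-+ zero    u x = ≡.refl
  iterate-+ (suc r) u x = ≡.cong f (iterate-+ r u x)

  iterate-suc : ∀ k x → f (iterate F f k x) ≡ iterate F f k (f x)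
  iterate-suc zero    x = ≡.refl
  iterate-suc (suc k) x = ≡.cong f (iterate-suc k x)

  module _ (f-cong : ∀ {x y} → x ≈ y → f x ≈ f y) where
    iterate-cong : ∀ k {x y} → x ≈ y → iterate F f k x ≈ iterate F f k y
    iterate-cong zero    x≈y = x≈y
    iterate-cong (suc k) x≈y = f-cong (iterate-cong k x≈y)

    iterate-multiple : ∀ r t {x} → iterate F f r x ≈ x → iterate F f (t Nat.* r) x ≈ x
    iterate-multiple r zero    fʳx≈x = refl
    iterate-multiple r (suc t) {x} fʳx≈x =
      trans (reflexive (iterate-+ r (t Nat.* r) x)) (trans (iterate-cong r (iterate-multiple r t fʳx≈x)) fʳx≈x)

  module _ {s} (S : Carrier → Set s) (maps : ∀ {x} → S x → S (f x)) where
    iterate-preserves : ∀ k {x} → S x → S (iterate F f k x)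
    iterate-preserves zero    Sx = Sx
    iterate-preserves (suc k) Sx = maps (iterate-preserves k Sx)

    iterate-cancel : (∀ {x y} → S x → S y → f x ≈ f y → x ≈ y) →
      ∀ k {x y} → S x → S y → iterate F f k x ≈ iterate F f k y → x ≈ y
    iterate-cancel inj zero    Sx Sy eq = eq
    iterate-cancel inj (suc k) Sx Sy eq =
      iterate-cancel inj k Sx Sy (inj (iterate-preserves k Sx) (iterate-preserves k Sy) eq)

    -- If fᵘ x = fᵛ x with u < v, then fᵘ x = fᵘ (f^(v-u) x); cancelling fᵘ on S
    -- shows that x has period v - u.
    collision⇒periodic : (∀ {x y} → S x → S y → f x ≈ f y → x ≈ y) →
      ∀ {u v x} → S x → u Nat.< v → iterate F f u x ≈ iterate F f v x → IsPeriodicPoint F f x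
    collision⇒periodic inj {u} {v} {x} Sx u<v fᵘx≈fᵛx =
      v ∸ u , ℕP.m<n⇒0<n∸m u<v ,
      sym (iterate-cancel inj u Sx (iterate-preserves (v ∸ u) Sx) (trans fᵘx≈fᵛx (reflexive fᵛ≡fᵘfᵛ⁻ᵘ)))
      where
      fᵛ≡fᵘfᵛ⁻ᵘ : iterate F f v x ≡ iterate F f u (iterate F f (v ∸ u) x)
      fᵛ≡fᵘfᵛ⁻ᵘ = ≡.trans (≡.cong (λ t → iterate F f t x) (≡.sym (ℕP.m+[n∸m]≡n (ℕP.<⇒≤ u<v))))
                          (iterate-+ u (v ∸ u) x)

module FieldLemmas {c ℓ} (F : CommutativeRing c ℓ) (isField : IsField F) where
  open CommutativeRing F hiding (zero)
  open import Algebra.Properties.Semiring.Exp semiring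
  open import Algebra.Properties.Group +-group using (x∙y⁻¹≈ε⇒x≈y)
  open import Algebra.Solver.Ring.NaturalCoefficients.Default commutativeSemiring
  open import Relation.Binary.Reasoning.Setoid setoid

  Nonzero : Carrier → Set ℓ
  Nonzero x = ¬ (x ≈ 0#)

  1≉0 : Nonzero 1#
  1≉0 = proj₁ isField

  inverse : ∀ x → Nonzero x → Carrier
  inverse x x≉0 = proj₁ (proj₂ isField x x≉0)

  inverseʳ : ∀ x (x≉0 : Nonzero x) → x * inverse x x≉0 ≈ 1#
  inverseʳ x x≉0 = proj₂ (proj₂ isField x x≉0)

  inverseˡ : ∀ x (x≉0 : Nonzero x) → inverse x x≉0 * x ≈ 1#
  inverseˡ x x≉0 = trans (*-comm _ _) (inverseʳ x x≉0)

  *-cancelˡ : ∀ x {y z} → Nonzero x → x * y ≈ x * z → y ≈ z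
  *-cancelˡ x {y} {z} x≉0 eq = begin
    y                    ≈⟨ *-identityˡ y ⟨
    1# * y               ≈⟨ *-congʳ (inverseˡ x x≉0) ⟨
    (x⁻¹ * x) * y        ≈⟨ *-assoc _ _ _ ⟩
    x⁻¹ * (x * y)        ≈⟨ *-congˡ eq ⟩
    x⁻¹ * (x * z)        ≈⟨ *-assoc _ _ _ ⟨
    (x⁻¹ * x) * z        ≈⟨ *-congʳ (inverseˡ x x≉0) ⟩
    1# * z               ≈⟨ *-identityˡ z ⟩
    z                    ∎
    where x⁻¹ = inverse x x≉0

  *-cancelʳ : ∀ x {y z} → Nonzero x → y * x ≈ z * x → y ≈ z
  *-cancelʳ x x≉0 eq = *-cancelˡ x x≉0 (trans (*-comm _ _) (trans eq (*-comm _ _)))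

  *-nonzero : ∀ {x y} → Nonzero x → Nonzero y → Nonzero (x * y)
  *-nonzero {x} x≉0 y≉0 xy≈0 = y≉0 (*-cancelˡ x x≉0 (trans xy≈0 (sym (zeroʳ x))))

  ^-nonzero : ∀ {x} k → Nonzero x → Nonzero (x ^ k)
  ^-nonzero zero    x≉0 = 1≉0
  ^-nonzero (suc k) x≉0 = *-nonzero x≉0 (^-nonzero k x≉0)

  inverse-nonzero : ∀ x (x≉0 : Nonzero x) → Nonzero (inverse x x≉0)
  inverse-nonzero x x≉0 x⁻¹≈0 = 1≉0 (trans (sym (inverseʳ x x≉0)) (trans (*-congˡ x⁻¹≈0) (zeroʳ x)))

  0^ : ∀ k → k ≢ 0 → 0# ^ k ≈ 0#
  0^ zero    k≢0 = ⊥-elim (k≢0 ≡.refl)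
  0^ (suc k) _   = zeroˡ _

  1^ : ∀ k → 1# ^ k ≈ 1#
  1^ zero    = refl
  1^ (suc k) = trans (*-identityˡ _) (1^ k)

  ^-multiple : ∀ {x m N} → x ^ m ≈ 1# → m ∣ N → x ^ N ≈ 1#
  ^-multiple {x} {m} (xᵐ≈1) (divides t ≡.refl) = begin
    x ^ (t Nat.* m)     ≈⟨ ^-congʳ x (ℕP.*-comm t m) ⟩
    x ^ (m Nat.* t)     ≈⟨ ^-assocʳ x m t ⟨
    (x ^ m) ^ t         ≈⟨ ^-congˡ t xᵐ≈1 ⟩
    1# ^ t              ≈⟨ 1^ t ⟩
    1#                  ∎

  ^-lift : ∀ {x y} A u → x ^ A ≈ y ^ A → x ^ (u Nat.* A) ≈ y ^ (u Nat.* A)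
  ^-lift {x} {y} A u xᴬ≈yᴬ = begin
    x ^ (u Nat.* A)  ≈⟨ ^-congʳ x (ℕP.*-comm u A) ⟩
    x ^ (A Nat.* u)  ≈⟨ ^-assocʳ x A u ⟨
    (x ^ A) ^ u      ≈⟨ ^-congˡ u xᴬ≈yᴬ ⟩
    (y ^ A) ^ u      ≈⟨ ^-assocʳ y A u ⟩
    y ^ (A Nat.* u)  ≈⟨ ^-congʳ y (ℕP.*-comm A u) ⟩
    y ^ (u Nat.* A)  ∎

  ^-consecutive : ∀ {x y} P Q → Nonzero x → suc Q ≡ P → x ^ P ≈ y ^ P → x ^ Q ≈ y ^ Q → x ≈ y
  ^-consecutive {x} {y} P Q x≉0 P≡ xᴾ≈yᴾ xᵠ≈yᵠ = *-cancelʳ (x ^ Q) (^-nonzero Q x≉0) (begin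
    x * x ^ Q   ≈⟨ ^-congʳ x P≡ ⟩
    x ^ P       ≈⟨ xᴾ≈yᴾ ⟩
    y ^ P       ≈⟨ ^-congʳ y P≡ ⟨
    y * y ^ Q   ≈⟨ *-congˡ xᵠ≈yᵠ ⟨
    y * x ^ Q   ∎)

  -- For coprime A, B the map x ↦ (x^A, x^B) is injective on nonzero elements:
  -- a Bézout identity u·A = 1 + v·B (or the reverse) reduces it to ^-consecutive.
  ^-injective-coprime : ∀ {A B x y} → Coprime A B → Nonzero x → x ^ A ≈ y ^ A → x ^ B ≈ y ^ B → x ≈ y
  ^-injective-coprime {A} {B} A⊥B x≉0 xᴬ≈yᴬ xᴮ≈yᴮ with Coprimality.coprime-Bézout A⊥B
  ... | Bézout.+- u v eq = ^-consecutive (u Nat.* A) (v Nat.* B) x≉0 eq (^-lift A u xᴬ≈yᴬ) (^-lift B v xᴮ≈yᴮ)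
  ... | Bézout.-+ u v eq = ^-consecutive (v Nat.* B) (u Nat.* A) x≉0 eq (^-lift B v xᴮ≈yᴮ) (^-lift A u xᴬ≈yᴬ)

  -- Monic polynomials of degree D: coefficients c₀ … c_{D-1} below the leading 1,
  -- evaluated in Horner form.
  MonicPoly : ℕ → Set c
  MonicPoly D = Vec Carrier D

  eval : ∀ {D} → MonicPoly D → Carrier → Carrier
  eval []       x = 1#
  eval (k ∷ ks) x = x * eval ks x + k

  -- Synthetic division by (x - r): the quotient, again monic, of one lower degree.
  deflate : ∀ {D} → MonicPoly (suc D) → Carrier → MonicPoly D
  deflate (k ∷ [])       r = []
  deflate (k ∷ k' ∷ ks)  r = eval (k' ∷ ks) r ∷ deflate (k' ∷ ks) r

  x≈[x-r]+r : ∀ x r → x ≈ (x - r) + r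
  x≈[x-r]+r x r = begin
    x                 ≈⟨ +-identityʳ x ⟨
    x + 0#            ≈⟨ +-congˡ (-‿inverseˡ r) ⟨
    x + (- r + r)     ≈⟨ +-assoc _ _ _ ⟨
    (x - r) + r       ∎

  eval-deflate : ∀ {D} (p : MonicPoly (suc D)) x r → eval p x ≈ (x - r) * eval (deflate p r) x + eval p r
  eval-deflate (k ∷ []) x r = begin
    x * 1# + k                   ≈⟨ +-congʳ (*-congʳ (x≈[x-r]+r x r)) ⟩
    ((x - r) + r) * 1# + k       ≈⟨ solve 3 (λ t r k → (t :+ r) :* con 1 :+ k := t :* con 1 :+ (r :* con 1 :+ k))
                                          refl (x - r) r k ⟩
    (x - r) * 1# + (r * 1# + k)  ∎
  eval-deflate (k ∷ k' ∷ ks) x r = begin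
    x * P + k                              ≈⟨ +-congʳ (*-cong (x≈[x-r]+r x r) (eval-deflate (k' ∷ ks) x r)) ⟩
    (t + r) * (t * Q + Pr) + k             ≈⟨ solve 5 (λ t r Q Pr k → (t :+ r) :* (t :* Q :+ Pr) :+ k
                                                         := t :* ((t :+ r) :* Q :+ Pr) :+ (r :* Pr :+ k))
                                                refl t r Q Pr k ⟩
    t * ((t + r) * Q + Pr) + (r * Pr + k)  ≈⟨ +-congʳ (*-congˡ (+-congʳ (*-congʳ (x≈[x-r]+r x r)))) ⟨
    t * (x * Q + Pr) + (r * Pr + k)        ∎
    where
    t  = x - r
    P  = eval (k' ∷ ks) x
    Pr = eval (k' ∷ ks) r
    Q  = eval (deflate (k' ∷ ks) r) x

  root-bound : ∀ {D} (p : MonicPoly D) {k} (root : Fin k → Carrier) →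
    (∀ i j → root i ≈ root j → i ≡ j) → (∀ i → eval p (root i) ≈ 0#) → k ≤ D
  root-bound p         {zero}  root root-inj is-root = z≤n
  root-bound []        {suc k} root root-inj is-root = ⊥-elim (1≉0 (is-root zero))
  root-bound (c₀ ∷ cs) {suc k} root root-inj is-root =
    s≤s (root-bound (deflate p r) (root ∘ suc) (λ i j eq → FinP.suc-injective (root-inj _ _ eq)) deflated-root)
    where
    p = c₀ ∷ cs
    r = root zero
    -- every other root is a root of the quotient, as x - r is nonzero there
    deflated-root : ∀ i → eval (deflate p r) (root (suc i)) ≈ 0#
    deflated-root i = *-cancelˡ (y - r) y-r≉0 (begin
      (y - r) * eval (deflate p r) y            ≈⟨ +-identityʳ _ ⟨
      (y - r) * eval (deflate p r) y + 0#       ≈⟨ +-congˡ (is-root zero) ⟨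
      (y - r) * eval (deflate p r) y + eval p r ≈⟨ eval-deflate p y r ⟨
      eval p y                                  ≈⟨ is-root (suc i) ⟩
      0#                                        ≈⟨ zeroʳ (y - r) ⟨
      (y - r) * 0#                              ∎)
      where
      y = root (suc i)
      y-r≉0 : Nonzero (y - r)
      y-r≉0 y-r≈0 with root-inj _ _ (x∙y⁻¹≈ε⇒x≈y y r y-r≈0)
      ... | ()

  binomial : ∀ D → Carrier → MonicPoly (suc D)
  binomial D c = - c ∷ replicate D 0#

  eval-binomial : ∀ D c x → eval (binomial D c) x ≈ x ^ suc D - c
  eval-binomial D c x = +-congʳ (*-congˡ (eval-zeros D))
    where
    eval-zeros : ∀ D → eval (replicate D 0#) x ≈ x ^ D
    eval-zeros zero    = refl
    eval-zeros (suc D) = trans (+-identityʳ _) (*-congˡ (eval-zeros D))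

  power-root-bound : ∀ {D k} c (root : Fin k → Carrier) → D ≢ 0 →
    (∀ i j → root i ≈ root j → i ≡ j) → (∀ i → root i ^ D ≈ c) → k ≤ D
  power-root-bound {zero}  c root D≢0 root-inj is-root = ⊥-elim (D≢0 ≡.refl)
  power-root-bound {suc D} c root D≢0 root-inj is-root =
    root-bound (binomial D c) root root-inj λ i → begin
      eval (binomial D c) (root i)  ≈⟨ eval-binomial D c (root i) ⟩
      root i ^ suc D - c            ≈⟨ +-congʳ (is-root i) ⟩
      c - c                         ≈⟨ -‿inverseʳ c ⟩
      0#                            ∎

module FiniteField {c ℓ} (F : CommutativeRing c ℓ) (isField : IsField F)
                   (m : ℕ) (card : HasCardinality F (suc m)) where
  open CommutativeRing F hiding (zero)
  open import Algebra.Properties.Semiring.Exp semiring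
  open import Algebra.Properties.CommutativeSemiring.Exp commutativeSemiring using (^-distrib-*)
  import Algebra.Properties.CommutativeMonoid.Sum *-commutativeMonoid as Product
  open import Relation.Binary.Reasoning.Setoid setoid
  open FieldLemmas F isField
  open Enumeration F

  listing : Fin (suc m) → Carrier
  listing = proj₁ card

  listing-injective : ∀ i j → listing i ≈ listing j → i ≡ j
  listing-injective = proj₁ (proj₂ card)

  position : Carrier → Fin (suc m)
  position x = proj₁ (proj₂ (proj₂ card) x)

  listing-position : ∀ x → listing (position x) ≈ x
  listing-position x = proj₂ (proj₂ (proj₂ card) x)

  same-position : ∀ {x y} → position x ≡ position y → x ≈ y
  same-position {x} {y} eq =
    trans (sym (listing-position x)) (trans (reflexive (≡.cong listing eq)) (listing-position y))

  infix 4 _≟_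
  _≟_ : ∀ x y → Dec (x ≈ y)
  x ≟ y with position x FinP.≟ position y
  ... | yes eq  = yes (same-position eq)
  ... | no  neq = no λ x≈y → neq (listing-injective _ _
                    (trans (listing-position x) (trans x≈y (sym (listing-position y)))))

  -- A field has the two distinct elements 0 and 1, so m ≠ 0.
  m≢0 : m ≢ 0
  m≢0 ≡.refl = 1≉0 (same-position (≡.trans (only-zero (position 1#)) (≡.sym (only-zero (position 0#)))))
    where
    only-zero : (i : Fin 1) → i ≡ zero
    only-zero zero = ≡.refl

  enumerate : ∀ {p} (P : Carrier → Set p) → Decidable P → (∀ {x y} → x ≈ y → P x → P y) →
    ∃ λ k → CountIs F P k
  enumerate P P? P-resp = S.size , listing ∘ S.pick , injective , λ x → complete x , sound x
    where
    module S = Selection (select (suc m) (P ∘ listing) (P? ∘ listing))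
    injective : ∀ i j → listing (S.pick i) ≈ listing (S.pick j) → i ≡ j
    injective i j eq = S.pick-injective i j (listing-injective _ _ eq)
    complete : ∀ x → P x → ∃ λ j → listing (S.pick j) ≈ x
    complete x Px with S.pick-complete (position x) (P-resp (sym (listing-position x)) Px)
    ... | j , eq = j , trans (reflexive (≡.cong listing eq)) (listing-position x)
    sound : ∀ x → (∃ λ j → listing (S.pick j) ≈ x) → P x
    sound x (j , eq) = P-resp eq (S.pick-sound j)

  units : CountIs F Nonzero m
  units = u , u-injective , λ x → complete x , sound x
    where
    i₀ = position 0#
    u : Fin m → Carrier
    u j = listing (Fin.punchIn i₀ j)
    u-injective : ∀ i j → u i ≈ u j → i ≡ j
    u-injective i j eq = FinP.punchIn-injective i₀ i j (listing-injective _ _ eq)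
    complete : ∀ x → Nonzero x → ∃ λ j → u j ≈ x
    complete x x≉0 = Fin.punchOut i₀≢ ,
      trans (reflexive (≡.cong listing (FinP.punchIn-punchOut i₀≢))) (listing-position x)
      where
      i₀≢ : i₀ ≢ position x
      i₀≢ eq = x≉0 (sym (same-position eq))
    sound : ∀ x → (∃ λ j → u j ≈ x) → Nonzero x
    sound x (j , uj≈x) x≈0 =
      FinP.punchInᵢ≢i i₀ j (listing-injective _ _ (trans uj≈x (trans x≈0 (sym (listing-position 0#)))))

  -- Multiplication by a nonzero x permutes the units; on indices it is `scale x`.
  scale : ∀ x → Nonzero x → Fin m → Fin m
  scale x x≉0 j = index units (x * element units j) (*-nonzero x≉0 (element-sound units j))

  element-scale : ∀ x (x≉0 : Nonzero x) j → element units (scale x x≉0 j) ≈ x * element units j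
  element-scale x x≉0 j = element-index units (x * element units j) (*-nonzero x≉0 (element-sound units j))

  scale-inverse : ∀ x y (x≉0 : Nonzero x) (y≉0 : Nonzero y) → x * y ≈ 1# → ∀ j → scale x x≉0 (scale y y≉0 j) ≡ j
  scale-inverse x y x≉0 y≉0 xy≈1 j = element-injective units _ _ (begin
    element units (scale x x≉0 (scale y y≉0 j))  ≈⟨ element-scale x x≉0 _ ⟩
    x * element units (scale y y≉0 j)             ≈⟨ *-congˡ (element-scale y y≉0 j) ⟩
    x * (y * element units j)                     ≈⟨ *-assoc _ _ _ ⟨
    (x * y) * element units j                     ≈⟨ *-congʳ xy≈1 ⟩
    1# * element units j                          ≈⟨ *-identityˡ _ ⟩
    element units j                               ∎)

  -- Lagrange's theorem for the multiplicative group: comparing the product of all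
  -- units with the product of their x-multiples gives x^m = 1.
  lagrange : ∀ x → Nonzero x → x ^ m ≈ 1#
  lagrange x x≉0 = sym (*-cancelʳ Π (prod-nonzero m (element units) (element-sound units)) (begin
    1# * Π                                 ≈⟨ *-identityˡ Π ⟩
    Π                                      ≈⟨ Product.sum-permute (element units) π ⟩
    Product.sum (element units ∘ σ)        ≈⟨ Product.sum-cong-≋ (element-scale x x≉0) ⟩
    Product.sum (λ j → x * element units j) ≈⟨ Product.∑-distrib-+ (λ _ → x) (element units) ⟩
    Product.sum {m} (λ _ → x) * Π          ≈⟨ *-congʳ (Product.sum-replicate m) ⟩
    x ^ m * Π                              ∎))
    where
    Π = Product.sum (element units)
    x⁻¹ = inverse x x≉0
    x⁻¹≉0 = inverse-nonzero x x≉0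
    σ = scale x x≉0
    π = permutation σ (scale x⁻¹ x⁻¹≉0)
          (scale-inverse x x⁻¹ x≉0 x⁻¹≉0 (inverseʳ x x≉0))
          (scale-inverse x⁻¹ x x⁻¹≉0 x≉0 (inverseˡ x x≉0))
    prod-nonzero : ∀ k (f : Fin k → Carrier) → (∀ i → Nonzero (f i)) → Nonzero (Product.sum f)
    prod-nonzero zero    f f≉0 = 1≉0
    prod-nonzero (suc k) f f≉0 = *-nonzero (f≉0 zero) (prod-nonzero k (f ∘ suc) (f≉0 ∘ suc))

  -- If m = e·d with d, e coprime and b ≠ 0, then x^d = b^d has exactly d solutions:
  -- at most d as roots of x^d - b^d, and at least d since x ↦ (b·x^e, x^d) maps the
  -- m units injectively into pairs (solution, e-th root of unity), of which there
  -- are at most d·e = m.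
  power-count : ∀ {d e k b} → m ≡ e Nat.* d → Coprime d e → Nonzero b →
    CountIs F (λ x → x ^ d ≈ b ^ d) k → k ≡ d
  power-count {d} {e} {k} {b} m≡ed d⊥e b≉0 T = ℕP.≤-antisym k≤d d≤k
    where
    e≢0 = proj₁ (factors-nonzero e d m≢0 m≡ed)
    d≢0 = proj₂ (factors-nonzero e d m≢0 m≡ed)
    unity : ∃ λ l → CountIs F (λ x → x ^ e ≈ 1#) l
    unity = enumerate _ (λ x → x ^ e ≟ 1#) (λ x≈y xᵉ≈1 → trans (^-congˡ e (sym x≈y)) xᵉ≈1)
    l = proj₁ unity
    U = proj₂ unity
    k≤d : k ≤ d
    k≤d = power-root-bound (b ^ d) (element T) d≢0 (element-injective T) (element-sound T)
    l≤e : l ≤ e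
    l≤e = power-root-bound 1# (element U) e≢0 (element-injective U) (element-sound U)
    ^ed≈1 : ∀ x → Nonzero x → x ^ (e Nat.* d) ≈ 1#
    ^ed≈1 x x≉0 = trans (^-congʳ x (≡.sym m≡ed)) (lagrange x x≉0)
    into-T : ∀ x → Nonzero x → (b * x ^ e) ^ d ≈ b ^ d
    into-T x x≉0 = begin
      (b * x ^ e) ^ d       ≈⟨ ^-distrib-* b (x ^ e) d ⟩
      b ^ d * (x ^ e) ^ d   ≈⟨ *-congˡ (^-assocʳ x e d) ⟩
      b ^ d * x ^ (e Nat.* d) ≈⟨ *-congˡ (^ed≈1 x x≉0) ⟩
      b ^ d * 1#            ≈⟨ *-identityʳ _ ⟩
      b ^ d                 ∎
    into-U : ∀ x → Nonzero x → (x ^ d) ^ e ≈ 1#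
    into-U x x≉0 = trans (^-assocʳ x d e) (trans (^-congʳ x (ℕP.*-comm d e)) (^ed≈1 x x≉0))
    m≤kl : m ≤ k Nat.* l
    m≤kl = count-≤-× units T U (λ x → b * x ^ e) (λ x → x ^ d) into-T into-U
      λ x y x≉0 _ eqT eqU → ^-injective-coprime (Coprimality.sym d⊥e) x≉0 (*-cancelˡ b b≉0 eqT) eqU
    d≤k : d ≤ k
    d≤k = ℕP.*-cancelʳ-≤ d k e {{Nat.≢-nonZero e≢0}}
            (ℕP.≤-trans (ℕP.≤-reflexive (≡.trans (ℕP.*-comm d e) (≡.sym m≡ed)))
                        (ℕP.≤-trans m≤kl (ℕP.*-monoʳ-≤ k l≤e)))

  -- An injective self-map of an invariant subset S of the finite field permutes S,
  -- so every point of S is periodic: two of its first m + 2 iterates coincide.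
  periodic-on-invariant : ∀ {s} (f : Carrier → Carrier) (S : Carrier → Set s) →
    (∀ {x} → S x → S (f x)) → (∀ {x y} → S x → S y → f x ≈ f y → x ≈ y) →
    ∀ {x} → S x → IsPeriodicPoint F f x
  periodic-on-invariant f S maps inj {x} Sx
    with FinP.pigeonhole (ℕP.n<1+n (suc m)) (λ i → position (iterate F f (Fin.toℕ i) x))
  ... | _ , _ , i<j , same = Iteration.collision⇒periodic F f S maps inj Sx i<j (same-position same)

  -- Write m = e·d with e ∣ n^K (largest-coprime-cofactor) and let
  -- T = {x | x^d = b} with b = (f^K 1)^d.  The periodic points are 0 and T.
  module PowerMap (n : ℕ) (n≢0 : n ≢ 0) (a : Carrier) (a≉0 : Nonzero a)
                  (d : ℕ) (largest : IsLargestCoprimeDivisor d m n) where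
    open CoprimeCofactor (largest-coprime-cofactor m≢0 largest)

    f : Carrier → Carrier
    f = powerMap F a n

    f-cong : ∀ {x y} → x ≈ y → f x ≈ f y
    f-cong x≈y = *-congˡ (^-congˡ n x≈y)

    open Iteration F f

    f-nonzero : ∀ {x} → Nonzero x → Nonzero (f x)
    f-nonzero x≉0 = *-nonzero a≉0 (^-nonzero n x≉0)

    iterate-formula : ∀ k y → iterate F f k y ≈ iterate F f k 1# * y ^ (n Nat.^ k)
    iterate-formula zero    y = sym (trans (*-identityˡ _) (*-identityʳ y))
    iterate-formula (suc k) y = begin
      a * (iterate F f k y) ^ n                    ≈⟨ *-congˡ (^-congˡ n (iterate-formula k y)) ⟩
      a * (cₖ * y ^ (n Nat.^ k)) ^ n               ≈⟨ *-congˡ (^-distrib-* cₖ _ n) ⟩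
      a * (cₖ ^ n * (y ^ (n Nat.^ k)) ^ n)         ≈⟨ *-assoc _ _ _ ⟨
      (a * cₖ ^ n) * (y ^ (n Nat.^ k)) ^ n         ≈⟨ *-congˡ (^-assocʳ y (n Nat.^ k) n) ⟩
      (a * cₖ ^ n) * y ^ (n Nat.^ k Nat.* n)       ≈⟨ *-congˡ (^-congʳ y (ℕP.*-comm (n Nat.^ k) n)) ⟩
      (a * cₖ ^ n) * y ^ (n Nat.^ suc k)           ∎
      where cₖ = iterate F f k 1#

    c₀ : Carrier
    c₀ = iterate F f K 1#

    c₀≉0 : Nonzero c₀
    c₀≉0 = iterate-preserves Nonzero f-nonzero K 1≉0

    InT : Carrier → Set ℓ
    InT x = x ^ d ≈ c₀ ^ d

    -- After K steps every nonzero point lies in T, since m = e·d divides n^K·d.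
    lands-in-T : ∀ y → Nonzero y → InT (iterate F f K y)
    lands-in-T y y≉0 = begin
      (iterate F f K y) ^ d                    ≈⟨ ^-congˡ d (iterate-formula K y) ⟩
      (c₀ * y ^ (n Nat.^ K)) ^ d               ≈⟨ ^-distrib-* c₀ _ d ⟩
      c₀ ^ d * (y ^ (n Nat.^ K)) ^ d           ≈⟨ *-congˡ (^-assocʳ y (n Nat.^ K) d) ⟩
      c₀ ^ d * y ^ (n Nat.^ K Nat.* d)         ≈⟨ *-congˡ (^-multiple (lagrange y y≉0) m∣nᴷd) ⟩
      c₀ ^ d * 1#                              ≈⟨ *-identityʳ _ ⟩
      c₀ ^ d                                   ∎
      where
      m∣nᴷd : m ∣ n Nat.^ K Nat.* d
      m∣nᴷd = ≡.subst (_∣ n Nat.^ K Nat.* d) (≡.sym m≡e*d) (*-monoˡ-∣ d e∣nᴷ)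

    f-respects-^d : ∀ {x y} → x ^ d ≈ y ^ d → f x ^ d ≈ f y ^ d
    f-respects-^d {x} {y} xᵈ≈yᵈ = begin
      (a * x ^ n) ^ d       ≈⟨ ^-distrib-* a (x ^ n) d ⟩
      a ^ d * (x ^ n) ^ d   ≈⟨ *-congˡ (swap x) ⟩
      a ^ d * (x ^ d) ^ n   ≈⟨ *-congˡ (^-congˡ n xᵈ≈yᵈ) ⟩
      a ^ d * (y ^ d) ^ n   ≈⟨ *-congˡ (swap y) ⟨
      a ^ d * (y ^ n) ^ d   ≈⟨ ^-distrib-* a (y ^ n) d ⟨
      (a * y ^ n) ^ d       ∎
      where
      swap : ∀ z → (z ^ n) ^ d ≈ (z ^ d) ^ n
      swap z = trans (^-assocʳ z n d) (trans (^-congʳ z (ℕP.*-comm n d)) (sym (^-assocʳ z d n)))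

    -- T is f-invariant: f(x) has the d-th power of f(c₀) = f^K(f 1), which lies in T.
    T-invariant : ∀ {x} → InT x → InT (f x)
    T-invariant Tx = trans (f-respects-^d Tx)
      (trans (reflexive (≡.cong (_^ d) (iterate-suc K 1#))) (lands-in-T (f 1#) (f-nonzero 1≉0)))

    T-nonzero : ∀ {x} → InT x → Nonzero x
    T-nonzero {x} Tx x≈0 = ^-nonzero d c₀≉0 (begin
      c₀ ^ d   ≈⟨ Tx ⟨
      x ^ d    ≈⟨ ^-congˡ d x≈0 ⟩
      0# ^ d   ≈⟨ 0^ d (proj₂ (factors-nonzero e d m≢0 m≡e*d)) ⟩
      0#       ∎)

    -- On T, f is injective: f x = f y gives xⁿ = yⁿ, and xᵈ = yᵈ with gcd(d, n) = 1.
    f-injective-on-T : ∀ {x y} → InT x → InT y → f x ≈ f y → x ≈ y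
    f-injective-on-T Tx Ty fx≈fy =
      ^-injective-coprime (Coprimality.sym (proj₁ (proj₂ largest))) (T-nonzero Tx)
        (*-cancelˡ a a≉0 fx≈fy) (trans Tx (sym Ty))

    Periodic : Carrier → Set ℓ
    Periodic = IsPeriodicPoint F f

    0-periodic : ∀ {x} → x ≈ 0# → Periodic x
    0-periodic {x} x≈0 = 1 , s≤s z≤n , (begin
      a * x ^ n                ≈⟨ *-congˡ (^-congˡ n x≈0) ⟩
      a * 0# ^ n               ≈⟨ *-congˡ (0^ n n≢0) ⟩
      a * 0#                   ≈⟨ zeroʳ a ⟩
      0#                       ≈⟨ x≈0 ⟨
      x                        ∎)

    -- A nonzero point of period r + 1 equals f^(K(r+1))(x) = f^K(f^(rK) x), the
    -- image under f^K of a nonzero point, so it lies in T.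
    periodic⇒T : ∀ {x} → Nonzero x → Periodic x → InT x
    periodic⇒T {x} x≉0 (suc r , _ , fʳ⁺¹x≈x) =
      trans (^-congˡ d (sym fᴷy≈x)) (lands-in-T y (iterate-preserves Nonzero f-nonzero (r Nat.* K) x≉0))
      where
      y = iterate F f (r Nat.* K) x
      fᴷy≈x : iterate F f K y ≈ x
      fᴷy≈x = trans (reflexive (≡.sym (iterate-+ K (r Nat.* K) x)))
                (trans (reflexive (≡.cong (λ t → iterate F f t x) (ℕP.*-comm (suc r) K)))
                       (iterate-multiple f-cong (suc r) K fʳ⁺¹x≈x))

    periodic-classification : ∀ x → Periodic x → x ≈ 0# ⊎ InT x
    periodic-classification x per with x ≟ 0#
    ... | yes x≈0 = inj₁ x≈0
    ... | no  x≉0 = inj₂ (periodic⇒T x≉0 per)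

    T-periodic : ∀ {x} → InT x → Periodic x
    T-periodic = periodic-on-invariant f InT T-invariant f-injective-on-T

    periodic-count : CountIs F Periodic (suc d)
    periodic-count = ≡.subst (λ k → CountIs F Periodic (suc k)) (power-count m≡e*d d⊥e c₀≉0 (proj₂ T))
      (count-insert 0# (λ T0 → T-nonzero T0 refl) T-resp periodic-classification
        (λ x → [ 0-periodic , T-periodic ]) (proj₂ T))
      where
      T-resp : ∀ {x y} → x ≈ y → InT x → InT y
      T-resp x≈y Tx = trans (^-congˡ d (sym x≈y)) Tx
      T : ∃ λ k → CountIs F InT k
      T = enumerate InT (λ x → x ^ d ≟ c₀ ^ d) T-resp

-- The theorem: q ≠ 0 since 0 has a position in the listing, so q = m + 1 and the
-- count is PowerMap.periodic-count (n ≠ 0 is all that 2 ≤ n is needed for).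
lemma5p3 : ∀ {c ℓ} (F : CommutativeRing c ℓ) → IsField F →
    (q : ℕ) → HasCardinality F q →
    (n : ℕ) → 2 ≤ n →
    (a : CommutativeRing.Carrier F) → ¬ (CommutativeRing._≈_ F a (CommutativeRing.0# F)) →
    (d : ℕ) → IsLargestCoprimeDivisor d (q ∸ 1) n →
    CountIs F (IsPeriodicPoint F (powerMap F a n)) (suc d)
lemma5p3 F isField zero    card n 2≤n a a≉0 d largest =
  ⊥-elim (FinP.¬Fin0 (proj₁ (proj₂ (proj₂ card) (CommutativeRing.0# F))))
lemma5p3 F isField (suc m) card n 2≤n a a≉0 d largest =
  FiniteField.PowerMap.periodic-count F isField m card n (ℕP.m<n⇒n≢0 2≤n) a a≉0 d largest
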